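{- Let $\mathbb{F}\subset\mathbb{K}$ be fields of characteristic zero and let $a\colon\mathbb{F}\to\mathbb{K}$ be an additive mapping such that \[ 2\,a(x^{6})-9\,x^{2}a(x^{4})-4\,x^{3}a(x^{3})+36\,x^{4}a(x^{2})-36\,x^{5}a(x)=0\qquad(x\in\mathbb{F}). \] Then $a$ is a derivation of order $3$.
   Context: Derivations of higher order are defined recursively: the identically zero map is the only derivation of order $0$; for $m\geq1$, an additive map $d\colon\mathbb{F}\to\mathbb{K}$ is a derivation of order $m$ if there exists $B\colon\mathbb{F}\times\mathbb{F}\to\mathbb{K}$ which is a derivation of order $m-1$ in each variable and $d(xy)-xd(y)-d(x)y=B(x,y)$ for all $x,y\in\mathbb{F}$. -}

module Defs where

open import Level using (Level; _⊔_; suc)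
open import Data.Nat using (ℕ; zero) renaming (suc to sucℕ)
open import Data.Product using (Σ; ∃; _×_)
open import Relation.Nullary using (¬_)
open import Algebra.Bundles using (CommutativeRing)
open import Algebra.Morphism.Structures using (module RingMorphisms)

record Field (c ℓ : Level) : Set (suc (c ⊔ ℓ)) where
  field
    commutativeRing : CommutativeRing c ℓ
  open CommutativeRing commutativeRing public
  field
    1≉0     : ¬ (1# ≈ 0#)
    inverse : ∀ x → ¬ (x ≈ 0#) → ∃ λ y → x * y ≈ 1#

module _ {c ℓ : Level} (F : Field c ℓ) where
  open Field F

  natCast : ℕ → Carrier
  natCast zero = 0#
  natCast (sucℕ n) = 1# + natCast n

  pow : Carrier → ℕ → Carrier
  pow x zero = 1#
  pow x (sucℕ n) = x * pow x n

  CharZero : Set ℓ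
  CharZero = ∀ n → ¬ (natCast (sucℕ n) ≈ 0#)

-- A field extension F ⊂ K, given by an (automatically injective) ring
-- homomorphism ι : F → K (the inclusion).
IsFieldEmbedding : ∀ {c ℓ c' ℓ'} (F : Field c ℓ) (K : Field c' ℓ') →
                   (Field.Carrier F → Field.Carrier K) → Set (c ⊔ ℓ ⊔ ℓ')
IsFieldEmbedding F K ι =
  RingMorphisms.IsRingHomomorphism (Field.rawRing F) (Field.rawRing K) ι

module _ {c ℓ c' ℓ'} (F : Field c ℓ) (K : Field c' ℓ')
         (ι : Field.Carrier F → Field.Carrier K) where
  private
    module F = Field F
    module K = Field K

  Congruent : (F.Carrier → K.Carrier) → Set (c ⊔ ℓ ⊔ ℓ')
  Congruent d = ∀ {x y} → x F.≈ y → d x K.≈ d y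

  Additive : (F.Carrier → K.Carrier) → Set (c ⊔ ℓ')
  Additive d = ∀ x y → d (x F.+ y) K.≈ d x K.+ d y

  IsDerivationOfOrder : ℕ → (F.Carrier → K.Carrier) → Set (c ⊔ ℓ ⊔ c' ⊔ ℓ')
  IsDerivationOfOrder zero d = Level.Lift (c ⊔ ℓ ⊔ c') (∀ x → d x K.≈ K.0#)
  IsDerivationOfOrder (sucℕ m) d =
    Congruent d × Additive d ×
    Σ (F.Carrier → F.Carrier → K.Carrier) λ B →
      (∀ y → IsDerivationOfOrder m (λ x → B x y)) ×
      (∀ x → IsDerivationOfOrder m (λ y → B x y)) ×
      (∀ x y → (d (x F.* y) K.- ι x K.* d y) K.- d x K.* ι y K.≈ B x y)

{-# OPTIONS --safe #-}

-- Write B(x, y) = a(xy) − x a(y) − a(x) y for the defect of a and iterate it: the map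
-- G(x, y, z, w) obtained by taking defects in y, z, w in turn is additive and symmetric in all
-- four arguments, and a is a derivation of order 3 as soon as G vanishes. By polarization (which
-- only needs to divide by 12 and 2) G vanishes once its diagonal
--   G(t, t, t, t) = a(t⁴) − 4t a(t³) + 6t² a(t²) − 4t³ a(t)
-- does. For this, put x = 1 in the equation to get −11 a(1) = 0; then put x + 2, x + 1 and x,
-- expand a((x + k)ⁿ) binomially using additivity, and form the second difference: it is exactly
-- 42 times the quartic expression above.

module Submission where

open import Defs
open import Level using (Level; 0ℓ; lift)
open import Algebra.Bundles using (CommutativeRing; RawRing)
open import Algebra.Morphism.Structures using (module RingMorphisms)
open import Algebra.Solver.Ring.AlmostCommutativeRing
  using (fromCommutativeRing; _-Raw-AlmostCommutative⟶_)
open import Data.Nat as ℕ using (ℕ; zero; suc; _∸_)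
open import Data.Nat.GeneralisedArithmetic using (iterate)
import Data.Nat.Properties as ℕ
open import Data.Nat.Combinatorics using (_C_)
open import Data.Integer as ℤ using (ℤ; +_; -[1+_]; _⊖_)
import Data.Integer.Properties as ℤ
open import Data.Fin as Fin using (Fin; toℕ)
open import Data.Vec using (Vec; []; _∷_; replicate)
open import Data.Maybe using (Maybe; just; nothing)
open import Relation.Nullary using (yes; no)
open import Function using (_∘_)
open import Data.Product using (_,_)
open import Relation.Binary.PropositionalEquality as ≡ using (_≡_)

-- The expressions are written once over a raw ring, so that instantiating them at solver syntax
-- (IntegerCoefficients.Syntax) gives polynomials whose semantics is definitionally the expression.
module Formulas {c ℓ} (R : RawRing c ℓ) where
  open RawRing R
  open import Algebra.Definitions.RawSemiring rawSemiring public using (_×_; _^_; sum)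

  infixl 6 _-_
  _-_ : Carrier → Carrier → Carrier
  x - y = x + - y

  defectExpr : (fxy ξ fy fx η : Carrier) → Carrier
  defectExpr fxy ξ fy fx η = (fxy - ξ * fy) - fx * η

  -- The defect at (x, w) of the defect of g in z, in terms of the values of g and of
  -- ξ, ζ, ω = ι x, ι z, ι w (with ι (x w) = ξ ω).
  secondDefectExpr : (gxzw gzw ξ ζ ω gx gz gw gxz gxw : Carrier) → Carrier
  secondDefectExpr gxzw gzw ξ ζ ω gx gz gw gxz gxw =
    defectExpr (defectExpr gxzw (ξ * ω) gz gxw ζ) ξ
               (defectExpr gzw ω gz gw ζ) (defectExpr gxz ξ gz gx ζ) ω

  -- The defect in t on powers of t, in terms of φ j = h (tʲ) and τ = ι t.
  powerDefect : Carrier → (ℕ → Carrier) → ℕ → Carrier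
  powerDefect τ φ j = defectExpr (φ (suc j)) (τ ^ j) (φ 1) (φ j) τ

  quartic : (ξ b₄ b₃ b₂ b₁ : Carrier) → Carrier
  quartic ξ b₄ b₃ b₂ b₁ = ((b₄ - 4 × 1# * ξ * b₃) + 6 × 1# * ξ ^ 2 * b₂) - 4 × 1# * ξ ^ 3 * b₁

  -- Bracketed as in the hypothesis of lemma2p3, which is therefore an instance of it
  -- (n × 1# and natCast K n have the same normal form on numerals).
  sextic : (ξ b₆ b₄ b₃ b₂ b₁ : Carrier) → Carrier
  sextic ξ b₆ b₄ b₃ b₂ b₁ =
    (((2 × 1# * b₆ - 9 × 1# * ξ ^ 2 * b₄) - 4 × 1# * ξ ^ 3 * b₃) + 36 × 1# * ξ ^ 4 * b₂)
      - 36 × 1# * ξ ^ 5 * b₁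

  -- (A + κ)ⁿ expanded binomially, with Aⁱ read as A i.
  umbralPow : (ℕ → Carrier) → Carrier → ℕ → Carrier
  umbralPow A κ n = sum {suc n} λ k → (n C toℕ k) × (A (toℕ k) * κ ^ (n ∸ toℕ k))

  shiftedSextic : Carrier → Carrier → (ℕ → Carrier) → Carrier
  shiftedSextic κ ξ A = sextic (ξ + κ) (A⁺ 6) (A⁺ 4) (A⁺ 3) (A⁺ 2) (A⁺ 1)
    where A⁺ = umbralPow A κ

  dropConstant : (ℕ → Carrier) → ℕ → Carrier
  dropConstant A zero    = 0#
  dropConstant A (suc i) = A (suc i)

  -- E(x + 2) − 2 E(x + 1) + E(x) for the left-hand side E of the equation, with A i = a (xⁱ) and
  -- a(1) = 0 already used.
  secondDifference : Carrier → (ℕ → Carrier) → Carrier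
  secondDifference ξ A =
    (shiftedSextic (2 × 1#) ξ (dropConstant A) - 2 × shiftedSextic (1 × 1#) ξ (dropConstant A))
      + sextic ξ (A 6) (A 4) (A 3) (A 2) (A 1)

module IntegerCoefficients {c ℓ} (R : CommutativeRing c ℓ) where
  open CommutativeRing R
  open import Algebra.Properties.Ring ring using (-‿distribˡ-*; -‿distribʳ-*)
  open import Algebra.Properties.Group +-group using (ε⁻¹≈ε; ⁻¹-involutive)
  open import Algebra.Properties.AbelianGroup +-abelianGroup using (⁻¹-∙-comm)
  open import Algebra.Properties.Semiring.Mult.TCOptimised semiring
    using (_×_; ×-homo-+; ×1-homo-*)
  open import Algebra.Properties.CommutativeSemigroup +-commutativeSemigroup using (interchange)
  open import Relation.Binary.Reasoning.Setoid setoid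

  -- The optimised multiple gives ⟦ + 0 ⟧ℤ = 0# and ⟦ + 1 ⟧ℤ = 1# definitionally, which the
  -- definitional match between Formulas and Syntax relies on.
  ⟦_⟧ℤ : ℤ → Carrier
  ⟦ + n ⟧ℤ      = n × 1#
  ⟦ -[1+ n ] ⟧ℤ = - (suc n × 1#)

  ⟦suc⟧ : ∀ n → ⟦ + suc n ⟧ℤ ≈ 1# + ⟦ + n ⟧ℤ
  ⟦suc⟧ n = ×-homo-+ 1# 1 n

  ⟦-⟧ : ∀ i → ⟦ ℤ.- i ⟧ℤ ≈ - ⟦ i ⟧ℤ
  ⟦-⟧ (+ zero)  = sym ε⁻¹≈ε
  ⟦-⟧ (+ suc n) = refl
  ⟦-⟧ -[1+ n ]  = sym (⁻¹-involutive _)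

  ⟦⊖⟧ : ∀ m n → ⟦ m ⊖ n ⟧ℤ ≈ ⟦ + m ⟧ℤ - ⟦ + n ⟧ℤ
  ⟦⊖⟧ m       zero    = sym (trans (+-congˡ ε⁻¹≈ε) (+-identityʳ _))
  ⟦⊖⟧ zero    (suc n) = sym (+-identityˡ _)
  ⟦⊖⟧ (suc m) (suc n) = begin
    ⟦ suc m ⊖ suc n ⟧ℤ                        ≡⟨ ≡.cong ⟦_⟧ℤ (ℤ.[1+m]⊖[1+n]≡m⊖n m n) ⟩
    ⟦ m ⊖ n ⟧ℤ                                ≈⟨ ⟦⊖⟧ m n ⟩
    ⟦ + m ⟧ℤ - ⟦ + n ⟧ℤ                       ≈⟨ +-identityˡ _ ⟨
    0# + (⟦ + m ⟧ℤ - ⟦ + n ⟧ℤ)                ≈⟨ +-congʳ (-‿inverseʳ 1#) ⟨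
    (1# - 1#) + (⟦ + m ⟧ℤ - ⟦ + n ⟧ℤ)         ≈⟨ interchange _ _ _ _ ⟨
    (1# + ⟦ + m ⟧ℤ) + (- 1# - ⟦ + n ⟧ℤ)       ≈⟨ +-congˡ (⁻¹-∙-comm 1# _) ⟩
    (1# + ⟦ + m ⟧ℤ) - (1# + ⟦ + n ⟧ℤ)         ≈⟨ +-cong (⟦suc⟧ m) (-‿cong (⟦suc⟧ n)) ⟨
    ⟦ + suc m ⟧ℤ - ⟦ + suc n ⟧ℤ               ∎

  ⟦+⟧ : ∀ i j → ⟦ i ℤ.+ j ⟧ℤ ≈ ⟦ i ⟧ℤ + ⟦ j ⟧ℤ
  ⟦+⟧ (+ m)    (+ n)    = ×-homo-+ 1# m n
  ⟦+⟧ (+ m)    -[1+ n ] = ⟦⊖⟧ m (suc n)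
  ⟦+⟧ -[1+ m ] (+ n)    = trans (⟦⊖⟧ n (suc m)) (+-comm _ _)
  ⟦+⟧ -[1+ m ] -[1+ n ] = begin
    - (suc (suc (m ℕ.+ n)) × 1#)         ≡⟨ ≡.cong (λ k → - (k × 1#)) (ℕ.+-suc (suc m) n) ⟨
    - ((suc m ℕ.+ suc n) × 1#)           ≈⟨ -‿cong (×-homo-+ 1# (suc m) (suc n)) ⟩
    - (suc m × 1# + suc n × 1#)          ≈⟨ ⁻¹-∙-comm _ _ ⟨
    - (suc m × 1#) + - (suc n × 1#)      ∎

  ⟦+*⟧ : ∀ m j → ⟦ + m ℤ.* j ⟧ℤ ≈ ⟦ + m ⟧ℤ * ⟦ j ⟧ℤ
  ⟦+*⟧ m (+ n) = begin
    ⟦ + m ℤ.* + n ⟧ℤ            ≡⟨ ≡.cong ⟦_⟧ℤ (ℤ.pos-* m n) ⟨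
    (m ℕ.* n) × 1#              ≈⟨ ×1-homo-* m n ⟩
    m × 1# * n × 1#             ∎
  ⟦+*⟧ m -[1+ n ] = begin
    ⟦ + m ℤ.* ℤ.- + suc n ⟧ℤ    ≡⟨ ≡.cong ⟦_⟧ℤ (ℤ.neg-distribʳ-* (+ m) (+ suc n)) ⟨
    ⟦ ℤ.- (+ m ℤ.* + suc n) ⟧ℤ  ≈⟨ ⟦-⟧ (+ m ℤ.* + suc n) ⟩
    - ⟦ + m ℤ.* + suc n ⟧ℤ      ≈⟨ -‿cong (⟦+*⟧ m (+ suc n)) ⟩
    - (m × 1# * suc n × 1#)     ≈⟨ -‿distribʳ-* _ _ ⟩
    m × 1# * - (suc n × 1#)     ∎

  ⟦*⟧ : ∀ i j → ⟦ i ℤ.* j ⟧ℤ ≈ ⟦ i ⟧ℤ * ⟦ j ⟧ℤ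
  ⟦*⟧ (+ m)    j = ⟦+*⟧ m j
  ⟦*⟧ -[1+ m ] j = begin
    ⟦ ℤ.- + suc m ℤ.* j ⟧ℤ      ≡⟨ ≡.cong ⟦_⟧ℤ (ℤ.neg-distribˡ-* (+ suc m) j) ⟨
    ⟦ ℤ.- (+ suc m ℤ.* j) ⟧ℤ    ≈⟨ ⟦-⟧ (+ suc m ℤ.* j) ⟩
    - ⟦ + suc m ℤ.* j ⟧ℤ        ≈⟨ -‿cong (⟦+*⟧ (suc m) j) ⟩
    - (suc m × 1# * ⟦ j ⟧ℤ)     ≈⟨ -‿distribˡ-* _ _ ⟩
    - (suc m × 1#) * ⟦ j ⟧ℤ     ∎

  homomorphism : ℤ.+-*-rawRing -Raw-AlmostCommutative⟶ fromCommutativeRing R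
  homomorphism = record
    { ⟦_⟧    = ⟦_⟧ℤ
    ; +-homo = ⟦+⟧
    ; *-homo = ⟦*⟧
    ; -‿homo = ⟦-⟧
    ; 0-homo = refl
    ; 1-homo = refl
    }

  _≟⟦⟧_ : ∀ i j → Maybe (⟦ i ⟧ℤ ≈ ⟦ j ⟧ℤ)
  i ≟⟦⟧ j with i ℤ.≟ j
  ... | yes ≡.refl = just refl
  ... | no _       = nothing

  open import Algebra.Solver.Ring ℤ.+-*-rawRing (fromCommutativeRing R) homomorphism _≟⟦⟧_ public

  polynomialRawRing : ℕ → RawRing 0ℓ 0ℓ
  polynomialRawRing n = record
    { Carrier = Polynomial n
    ; _≈_     = _≡_
    ; _+_     = _:+_
    ; _*_     = _:*_
    ; -_      = :-_
    ; 0#      = con (+ 0)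
    ; 1#      = con (+ 1)
    }

  module Syntax {n} = Formulas (polynomialRawRing n)

module _ {c ℓ} (K : Field c ℓ) where
  open Field K
  open import Algebra.Properties.Semiring.Mult semiring using (_×_; ×-congʳ; ×-assoc-*)
  open import Relation.Binary.Reasoning.Setoid setoid

  natCast≡×1# : ∀ n → natCast K n ≡ n × 1#
  natCast≡×1# zero    = ≡.refl
  natCast≡×1# (suc n) = ≡.cong (_+_ 1#) (natCast≡×1# n)

  ×-cancel : CharZero K → ∀ n {y} → suc n × y ≈ 0# → y ≈ 0#
  ×-cancel charZero n {y} n×y≈0
    with inverse (suc n × 1#) (charZero n ∘ trans (reflexive (natCast≡×1# (suc n))))
  ... | z , n×z≈1 = begin
    y                         ≈⟨ *-identityˡ y ⟨
    1# * y                    ≈⟨ *-congʳ n×z≈1 ⟨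
    (suc n × 1#) * z * y      ≈⟨ *-congʳ (*-comm _ z) ⟩
    z * (suc n × 1#) * y      ≈⟨ *-assoc z _ y ⟩
    z * ((suc n × 1#) * y)    ≈⟨ *-congˡ (×-assoc-* (suc n) 1# y) ⟩
    z * (suc n × (1# * y))    ≈⟨ *-congˡ (trans (×-congʳ (suc n) (*-identityˡ y)) n×y≈0) ⟩
    z * 0#                    ≈⟨ zeroʳ z ⟩
    0#                        ∎

module FormulaIdentities {c ℓ} (R : CommutativeRing c ℓ) where
  open CommutativeRing R
  open Formulas rawRing
    using (_×_; _^_; defectExpr; secondDefectExpr; powerDefect; quartic; sextic; secondDifference; umbralPow)
  open IntegerCoefficients R using (solve; _:=_; _:+_; _:×_; :-_; con; module Syntax)
  open import Algebra.Properties.Semiring.Mult semiring using (×-congʳ)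
  open import Algebra.Properties.Semiring.Exp semiring using (^-congˡ)
  open import Algebra.Properties.Monoid.Sum +-monoid using (sum-cong-≋)

  defectExpr-cong : ∀ {a a' ξ ξ' b b' e e' η η'} → a ≈ a' → ξ ≈ ξ' → b ≈ b' → e ≈ e' → η ≈ η' →
                    defectExpr a ξ b e η ≈ defectExpr a' ξ' b' e' η'
  defectExpr-cong a≈ ξ≈ b≈ e≈ η≈ = +-cong (+-cong a≈ (-‿cong (*-cong ξ≈ b≈))) (-‿cong (*-cong e≈ η≈))

  sextic-cong : ∀ {ξ ξ' b₆ b₆' b₄ b₄' b₃ b₃' b₂ b₂' b₁ b₁'} →
                ξ ≈ ξ' → b₆ ≈ b₆' → b₄ ≈ b₄' → b₃ ≈ b₃' → b₂ ≈ b₂' → b₁ ≈ b₁' →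
                sextic ξ b₆ b₄ b₃ b₂ b₁ ≈ sextic ξ' b₆' b₄' b₃' b₂' b₁'
  sextic-cong {ξ} {ξ'} ξ≈ b₆≈ b₄≈ b₃≈ b₂≈ b₁≈ =
    +-cong (+-cong (+-cong (+-cong (*-congˡ b₆≈) (-‿cong (term 2 b₄≈))) (-‿cong (term 3 b₃≈))) (term 4 b₂≈))
           (-‿cong (term 5 b₁≈))
    where
    term : ∀ n {m b b'} → b ≈ b' → m * ξ ^ n * b ≈ m * ξ' ^ n * b'
    term n b≈ = *-cong (*-congˡ (^-congˡ n ξ≈)) b≈

  umbralPow-cong : ∀ {A B κ κ'} → (∀ i → A i ≈ B i) → κ ≈ κ' →
                   ∀ n → umbralPow A κ n ≈ umbralPow B κ' n
  umbralPow-cong A≈B κ≈κ' n = sum-cong-≋ {suc n} λ k →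
    ×-congʳ (n C toℕ k) (*-cong (A≈B (toℕ k)) (^-congˡ (n ∸ toℕ k) κ≈κ'))

  defectExpr-swap : ∀ a ξ b e η → defectExpr a ξ b e η ≈ defectExpr a η e b ξ
  defectExpr-swap =
    solve 5 (λ a ξ b e η → Syntax.defectExpr a ξ b e η := Syntax.defectExpr a η e b ξ) refl

  defectExpr-+ : ∀ a a' ξ ξ' b e e' η →
                 defectExpr (a + a') (ξ + ξ') b (e + e') η ≈
                 defectExpr a ξ b e η + defectExpr a' ξ' b e' η
  defectExpr-+ =
    solve 8 (λ a a' ξ ξ' b e e' η →
               Syntax.defectExpr (a :+ a') (ξ :+ ξ') b (e :+ e') η
                 := Syntax.defectExpr a ξ b e η :+ Syntax.defectExpr a' ξ' b e' η)
            refl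

  secondDefectExpr-swap : ∀ gxzw gzw ξ ζ ω gx gz gw gxz gxw →
                          secondDefectExpr gxzw gzw ξ ζ ω gx gz gw gxz gxw ≈
                          secondDefectExpr gxzw gzw ξ ω ζ gx gw gz gxw gxz
  secondDefectExpr-swap =
    solve 10 (λ gxzw gzw ξ ζ ω gx gz gw gxz gxw →
                Syntax.secondDefectExpr gxzw gzw ξ ζ ω gx gz gw gxz gxw
                  := Syntax.secondDefectExpr gxzw gzw ξ ω ζ gx gw gz gxw gxz)
             refl

  sextic-at-1# : ∀ b → 11 × b ≈ - sextic 1# b b b b b
  sextic-at-1# = solve 1 (λ b → 11 :× b := :- Syntax.sextic (con (+ 1)) b b b b b) refl

  powerDefect³ : ∀ τ φ → iterate (powerDefect τ) φ 3 1 ≈ quartic τ (φ 4) (φ 3) (φ 2) (φ 1)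
  powerDefect³ τ φ =
    solve 5 (λ τ φ₁ φ₂ φ₃ φ₄ →
               iterate (Syntax.powerDefect τ) (λ { 1 → φ₁ ; 2 → φ₂ ; 3 → φ₃ ; 4 → φ₄ ; _ → con (+ 0) })
                       3 1
                 := Syntax.quartic τ φ₄ φ₃ φ₂ φ₁)
            refl τ (φ 1) (φ 2) (φ 3) (φ 4)

  secondDifference-sextic : ∀ ξ A → secondDifference ξ A ≈ 42 × quartic ξ (A 4) (A 3) (A 2) (A 1)
  secondDifference-sextic ξ A =
    solve 7 (λ ξ a₁ a₂ a₃ a₄ a₅ a₆ →
               Syntax.secondDifference ξ
                 (λ { 1 → a₁ ; 2 → a₂ ; 3 → a₃ ; 4 → a₄ ; 5 → a₅ ; 6 → a₆ ; _ → con (+ 0) })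
                 := 42 :× Syntax.quartic ξ a₄ a₃ a₂ a₁)
            refl ξ (A 1) (A 2) (A 3) (A 4) (A 5) (A 6)

module AdditiveMap {f ℓf k ℓk} (F : Field f ℓf) (K : Field k ℓk) where
  private
    module F where
      open Field F public
      open Formulas rawRing public using (_×_; sum)
  open Field K
  open Formulas rawRing using (_×_; sum)
  open import Algebra.Properties.Group +-group using (identityʳ-unique; inverseʳ-unique)

  module _ {d : F.Carrier → Carrier} (d-cong : ∀ {x y} → x F.≈ y → d x ≈ d y)
           (d-add : ∀ x y → d (x F.+ y) ≈ d x + d y) where

    additive-0# : d F.0# ≈ 0#
    additive-0# = identityʳ-unique (d F.0#) (d F.0#)
      (trans (sym (d-add F.0# F.0#)) (d-cong (F.+-identityʳ F.0#)))

    additive-neg : ∀ x → d (F.- x) ≈ - d x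
    additive-neg x = inverseʳ-unique (d x) (d (F.- x))
      (trans (sym (d-add x (F.- x))) (trans (d-cong (F.-‿inverseʳ x)) additive-0#))

    additive-× : ∀ n x → d (n F.× x) ≈ n × d x
    additive-× zero    x = additive-0#
    additive-× (suc n) x = trans (d-add x (n F.× x)) (+-congˡ (additive-× n x))

    additive-sum : ∀ {n} (f : Fin n → F.Carrier) → d (F.sum f) ≈ sum (d ∘ f)
    additive-sum {zero}  f = additive-0#
    additive-sum {suc n} f = trans (d-add _ _) (+-congˡ (additive-sum (f ∘ Fin.suc)))

module FieldEmbedding {f ℓf k ℓk} (F : Field f ℓf) (K : Field k ℓk)
                      (ι : Field.Carrier F → Field.Carrier K) (ι-hom : IsFieldEmbedding F K ι) where
  private
    module F where
      open Field F public
      open Formulas rawRing public using (_×_; _^_)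
      open import Algebra.Properties.Semiring.Mult semiring public using (×-congʳ; ×-comm-*)
      open import Algebra.Properties.CommutativeSemiring.Binomial commutativeSemiring public
        using (binomialExpansion) renaming (theorem to binomial-theorem)
    module ι = RingMorphisms.IsRingHomomorphism ι-hom
  open Field K
  open Formulas rawRing using (_×_; _^_; sum; umbralPow)
  open import Algebra.Properties.Semiring.Mult semiring using (×-congʳ; ×-comm-*)
  open import Algebra.Properties.Monoid.Sum +-monoid using (sum-cong-≋)
  open AdditiveMap F K using (additive-×; additive-sum)
  open import Relation.Binary.Reasoning.Setoid setoid

  ι-^ : ∀ x n → ι (x F.^ n) ≈ ι x ^ n
  ι-^ x zero    = ι.1#-homo
  ι-^ x (suc n) = trans (ι.*-homo x (x F.^ n)) (*-congˡ (ι-^ x n))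

  ι-×1# : ∀ n → ι (n F.× F.1#) ≈ n × 1#
  ι-×1# n = trans (additive-× ι.⟦⟧-cong ι.+-homo n F.1#) (×-congʳ n ι.1#-homo)

  module _ {d : F.Carrier → Carrier} (d-cong : Congruent F K ι d) (d-add : Additive F K ι d) where

    scalar-^ : ∀ {c} → (∀ y → d (y F.* c) ≈ d y * ι c) → ∀ j y → d (y F.* c F.^ j) ≈ d y * ι c ^ j
    scalar-^ c-scalar zero    y = trans (d-cong (F.*-identityʳ y)) (sym (*-identityʳ (d y)))
    scalar-^ {c} c-scalar (suc j) y = begin
      d (y F.* (c F.* c F.^ j))  ≈⟨ d-cong (F.*-assoc y c _) ⟨
      d (y F.* c F.* c F.^ j)    ≈⟨ scalar-^ c-scalar j (y F.* c) ⟩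
      d (y F.* c) * ι c ^ j      ≈⟨ *-congʳ (c-scalar y) ⟩
      d y * ι c * ι c ^ j        ≈⟨ *-assoc _ _ _ ⟩
      d y * (ι c * ι c ^ j)      ∎

    natural-scalar : ∀ m y → d (y F.* m F.× F.1#) ≈ d y * ι (m F.× F.1#)
    natural-scalar m y = begin
      d (y F.* m F.× F.1#)    ≈⟨ d-cong (F.×-comm-* m y F.1#) ⟩
      d (m F.× (y F.* F.1#))  ≈⟨ d-cong (F.×-congʳ m (F.*-identityʳ y)) ⟩
      d (m F.× y)             ≈⟨ additive-× d-cong d-add m y ⟩
      m × d y                 ≈⟨ ×-congʳ m (*-identityʳ (d y)) ⟨
      m × (d y * 1#)          ≈⟨ ×-comm-* m (d y) 1# ⟨
      d y * m × 1#            ≈⟨ *-congˡ (ι-×1# m) ⟨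
      d y * ι (m F.× F.1#)    ∎

    additive-binomial : ∀ m n x →
      d ((x F.+ m F.× F.1#) F.^ n) ≈ umbralPow (λ i → d (x F.^ i)) (ι (m F.× F.1#)) n
    additive-binomial m n x = begin
      d ((x F.+ c) F.^ n)                ≈⟨ d-cong (F.binomial-theorem n x c) ⟩
      d (F.binomialExpansion x c n)      ≈⟨ additive-sum d-cong d-add term ⟩
      sum {suc n} (d ∘ term)             ≈⟨ sum-cong-≋ {suc n} d-term ⟩
      umbralPow (λ i → d (x F.^ i)) (ι c) n  ∎
      where
      c = m F.× F.1#
      term : Fin (suc n) → F.Carrier
      term k = (n C toℕ k) F.× (x F.^ toℕ k F.* c F.^ (n ∸ toℕ k))
      d-term : ∀ k → d (term k) ≈ (n C toℕ k) × (d (x F.^ toℕ k) * ι c ^ (n ∸ toℕ k))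
      d-term k = trans (additive-× d-cong d-add (n C toℕ k) _)
                       (×-congʳ (n C toℕ k) (scalar-^ (natural-scalar m) (n ∸ toℕ k) (x F.^ toℕ k)))

module Defects {f ℓf k ℓk} (F : Field f ℓf) (K : Field k ℓk)
               (ι : Field.Carrier F → Field.Carrier K) (ι-hom : IsFieldEmbedding F K ι) where
  private
    module F where
      open Field F public
      open Formulas rawRing public using (_^_)
      open import Algebra.Properties.CommutativeSemigroup *-commutativeSemigroup public using (xy∙z≈xz∙y)
    module ι = RingMorphisms.IsRingHomomorphism ι-hom
  open Field K
  open Formulas rawRing using (defectExpr; secondDefectExpr; powerDefect)
  open FormulaIdentities commutativeRing
    using (defectExpr-cong; defectExpr-swap; defectExpr-+; secondDefectExpr-swap)
  open FieldEmbedding F K ι ι-hom using (ι-^)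
  open import Relation.Binary.Reasoning.Setoid setoid

  defect : (F.Carrier → Carrier) → F.Carrier → F.Carrier → Carrier
  defect f x y = defectExpr (f (x F.* y)) (ι x) (f y) (f x) (ι y)

  iteratedDefect : ∀ {m} → (F.Carrier → Carrier) → Vec F.Carrier m → F.Carrier → Carrier
  iteratedDefect f []       = f
  iteratedDefect f (y ∷ ys) = iteratedDefect (λ x → defect f x y) ys

  module _ {f : F.Carrier → Carrier} (f-cong : Congruent F K ι f) where

    defect-cong : ∀ y → Congruent F K ι (λ x → defect f x y)
    defect-cong y x≈x' =
      defectExpr-cong (f-cong (F.*-congʳ x≈x')) (ι.⟦⟧-cong x≈x') refl (f-cong x≈x') refl

    defect-comm : ∀ x y → defect f x y ≈ defect f y x
    defect-comm x y =
      trans (defectExpr-cong (f-cong (F.*-comm x y)) refl refl refl refl) (defectExpr-swap _ _ _ _ _)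

    defect-additive : Additive F K ι f → ∀ y → Additive F K ι (λ x → defect f x y)
    defect-additive f-add y x x' = trans
      (defectExpr-cong (trans (f-cong (F.distribʳ y x x')) (f-add _ _)) (ι.+-homo x x') refl (f-add x x') refl)
      (defectExpr-+ _ _ _ _ _ _ _ _)

  defect-resp : ∀ {f g} → (∀ u → f u ≈ g u) → ∀ x y → defect f x y ≈ defect g x y
  defect-resp f≈g x y = defectExpr-cong (f≈g (x F.* y)) refl (f≈g y) (f≈g x) refl

  defect-exchange : ∀ {g} → Congruent F K ι g → ∀ x z w →
                    defect (λ u → defect g u z) x w ≈ defect (λ u → defect g u w) x z
  defect-exchange {g} g-cong x z w = begin
    defect (λ u → defect g u z) x w
      ≈⟨ defectExpr-cong (defectExpr-cong (g-cong (F.xy∙z≈xz∙y x w z)) (ι.*-homo x w) refl refl refl)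
                         refl (defectExpr-cong (g-cong (F.*-comm w z)) refl refl refl refl) refl refl ⟩
    secondDefectExpr gxzw gzw (ι x) (ι z) (ι w) (g x) (g z) (g w) (g (x F.* z)) (g (x F.* w))
      ≈⟨ secondDefectExpr-swap _ _ _ _ _ _ _ _ _ _ ⟩
    secondDefectExpr gxzw gzw (ι x) (ι w) (ι z) (g x) (g w) (g z) (g (x F.* w)) (g (x F.* z))
      ≈⟨ defectExpr-cong (defectExpr-cong refl (ι.*-homo x z) refl refl refl) refl refl refl refl ⟨
    defect (λ u → defect g u w) x z ∎
    where
    gxzw = g (x F.* z F.* w)
    gzw  = g (z F.* w)

  iteratedDefect-cong : ∀ {m f} → Congruent F K ι f →
                        (ys : Vec F.Carrier m) → Congruent F K ι (iteratedDefect f ys)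
  iteratedDefect-cong f-cong []       = f-cong
  iteratedDefect-cong f-cong (y ∷ ys) = iteratedDefect-cong (defect-cong f-cong y) ys

  iteratedDefect-additive : ∀ {m f} → Congruent F K ι f → Additive F K ι f →
                            (ys : Vec F.Carrier m) → Additive F K ι (iteratedDefect f ys)
  iteratedDefect-additive f-cong f-add []       = f-add
  iteratedDefect-additive f-cong f-add (y ∷ ys) =
    iteratedDefect-additive (defect-cong f-cong y) (defect-additive f-cong f-add y) ys

  isDerivationOfOrder-resp : ∀ m {f g} → (∀ x → f x ≈ g x) →
                             IsDerivationOfOrder F K ι m f → IsDerivationOfOrder F K ι m g
  isDerivationOfOrder-resp zero    f≈g (lift f≈0) = lift λ x → trans (sym (f≈g x)) (f≈0 x)
  isDerivationOfOrder-resp (suc m) f≈g (f-cong , f-add , B , B-left , B-right , f-defect) =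
    (λ x≈y → trans (sym (f≈g _)) (trans (f-cong x≈y) (f≈g _))) ,
    (λ x y → trans (sym (f≈g _)) (trans (f-add x y) (+-cong (f≈g x) (f≈g y)))) ,
    B , B-left , B-right ,
    (λ x y → trans (sym (defect-resp f≈g x y)) (f-defect x y))

  isDerivationOfOrder-suc : ∀ m {f} → Congruent F K ι f → Additive F K ι f →
                            (∀ y → IsDerivationOfOrder F K ι m (λ x → defect f x y)) →
                            IsDerivationOfOrder F K ι (suc m) f
  isDerivationOfOrder-suc m {f} f-cong f-add defect-order =
    f-cong , f-add , defect f , defect-order ,
    (λ x → isDerivationOfOrder-resp m (λ y → defect-comm f-cong y x) (defect-order x)) ,
    (λ x y → refl)

  isDerivationOfOrder-iteratedDefect : ∀ m {f} → Congruent F K ι f → Additive F K ι f →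
                                       (∀ (ys : Vec F.Carrier m) x → iteratedDefect f ys x ≈ 0#) →
                                       IsDerivationOfOrder F K ι m f
  isDerivationOfOrder-iteratedDefect zero    f-cong f-add vanishes = lift (vanishes [])
  isDerivationOfOrder-iteratedDefect (suc m) f-cong f-add vanishes =
    isDerivationOfOrder-suc m f-cong f-add λ y →
      isDerivationOfOrder-iteratedDefect m (defect-cong f-cong y) (defect-additive f-cong f-add y)
        (vanishes ∘ (y ∷_))

  iteratedDefect-powers : ∀ {h} → Congruent F K ι h → ∀ t {φ} → (∀ j → h (t F.^ j) ≈ φ j) →
                          ∀ k j → iteratedDefect h (replicate k t) (t F.^ j) ≈
                                  iterate (powerDefect (ι t)) φ k j
  iteratedDefect-powers h-cong t h≈φ zero    j = h≈φ j
  iteratedDefect-powers {h} h-cong t {φ} h≈φ (suc k) j =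
    iteratedDefect-powers (defect-cong h-cong t) t step k j
    where
    step : ∀ j → defect h (t F.^ j) t ≈ powerDefect (ι t) φ j
    step j = defectExpr-cong (trans (h-cong (F.*-comm _ t)) (h≈φ (suc j))) (ι-^ t j)
                             (trans (h-cong (F.sym (F.*-identityʳ t))) (h≈φ 1)) (h≈φ j) refl

module SymmetricQuadriadditive {f ℓf k ℓk} (F : Field f ℓf) (K : Field k ℓk) (charZero : CharZero K)
  where
  private
    module F = Field F
  open Field K
  open Formulas rawRing using (_×_)
  open import Algebra.Properties.Semiring.Mult semiring using (×-congʳ)
  open import Algebra.Properties.Group +-group using (⁻¹-involutive)
  open IntegerCoefficients commutativeRing using (solve; _:=_; _:+_; _:×_; :-_)
  open import Relation.Binary.Reasoning.Setoid setoid

  outer≈0⇒middle≈0 : ∀ {a b e} → a ≈ 0# → e ≈ 0# → a + b + e ≈ 0# → b ≈ 0#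
  outer≈0⇒middle≈0 {a} {b} {e} a≈0 e≈0 abe≈0 = begin
    b            ≈⟨ +-identityˡ b ⟨
    0# + b       ≈⟨ +-identityʳ _ ⟨
    0# + b + 0#  ≈⟨ +-cong (+-congʳ a≈0) e≈0 ⟨
    a + b + e    ≈⟨ abe≈0 ⟩
    0#           ∎

  module _ (G : F.Carrier → F.Carrier → F.Carrier → F.Carrier → Carrier)
           (G-cong : ∀ {x x'} y z w → x F.≈ x' → G x y z w ≈ G x' y z w)
           (G-additive : ∀ x x' y z w → G (x F.+ x') y z w ≈ G x y z w + G x' y z w)
           (G-swap₁₂ : ∀ x y z w → G x y z w ≈ G y x z w)
           (G-swap₂₃ : ∀ x y z w → G x y z w ≈ G x z y w)
           (G-swap₃₄ : ∀ x y z w → G x y z w ≈ G x y w z)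
           where

    G-swapPairs : ∀ x y z w → G x y z w ≈ G z w x y
    G-swapPairs x y z w = begin
      G x y z w  ≈⟨ G-swap₂₃ x y z w ⟩
      G x z y w  ≈⟨ G-swap₁₂ x z y w ⟩
      G z x y w  ≈⟨ G-swap₃₄ z x y w ⟩
      G z x w y  ≈⟨ G-swap₂₃ z x w y ⟩
      G z w x y  ∎

    G-additive₂ : ∀ x y y' z w → G x (y F.+ y') z w ≈ G x y z w + G x y' z w
    G-additive₂ x y y' z w = begin
      G x (y F.+ y') z w       ≈⟨ G-swap₁₂ x _ z w ⟩
      G (y F.+ y') x z w       ≈⟨ G-additive y y' x z w ⟩
      G y x z w + G y' x z w   ≈⟨ +-cong (G-swap₁₂ y x z w) (G-swap₁₂ y' x z w) ⟩
      G x y z w + G x y' z w   ∎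

    G-neg₁ : ∀ x y z w → G (F.- x) y z w ≈ - G x y z w
    G-neg₁ x y z w = AdditiveMap.additive-neg F K (G-cong y z w) (λ x x' → G-additive x x' y z w) x

    G-neg₄ : ∀ x y z w → G x y z (F.- w) ≈ - G x y z w
    G-neg₄ x y z w = begin
      G x y z (F.- w)  ≈⟨ G-swapPairs x y z _ ⟩
      G z (F.- w) x y  ≈⟨ G-swap₁₂ z _ x y ⟩
      G (F.- w) z x y  ≈⟨ G-neg₁ w z x y ⟩
      - G w z x y      ≈⟨ -‿cong (trans (G-swap₁₂ w z x y) (G-swapPairs z w x y)) ⟩
      - G x y z w      ∎

    G-neg₃ : ∀ x y z w → G x y (F.- z) w ≈ - G x y z w
    G-neg₃ x y z w =
      trans (G-swap₃₄ x y _ w) (trans (G-neg₄ x y w z) (-‿cong (sym (G-swap₃₄ x y z w))))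

    G-neg₂ : ∀ x y z w → G x (F.- y) z w ≈ - G x y z w
    G-neg₂ x y z w =
      trans (G-swap₁₂ x _ z w) (trans (G-neg₁ y x z w) (-‿cong (sym (G-swap₁₂ x y z w))))

    G-neg₃₄ : ∀ x y z w → G x y (F.- z) (F.- w) ≈ G x y z w
    G-neg₃₄ x y z w = trans (G-neg₃ x y z _) (trans (-‿cong (G-neg₄ x y z w)) (⁻¹-involutive _))

    pair-expansion₁₂ : ∀ x x' z w →
                       G (x F.+ x') (x F.+ x') z w ≈ G x x z w + 2 × G x x' z w + G x' x' z w
    pair-expansion₁₂ x x' z w = begin
      G (x F.+ x') (x F.+ x') z w
        ≈⟨ G-additive x x' _ z w ⟩
      G x (x F.+ x') z w + G x' (x F.+ x') z w
        ≈⟨ +-cong (G-additive₂ x x x' z w) (G-additive₂ x' x x' z w) ⟩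
      (G x x z w + G x x' z w) + (G x' x z w + G x' x' z w)
        ≈⟨ +-congˡ (+-congʳ (G-swap₁₂ x' x z w)) ⟩
      (G x x z w + G x x' z w) + (G x x' z w + G x' x' z w)
        ≈⟨ solve 3 (λ p q r → (p :+ q) :+ (q :+ r) := p :+ 2 :× q :+ r) refl _ _ _ ⟩
      G x x z w + 2 × G x x' z w + G x' x' z w ∎

    pair-expansion₃₄ : ∀ x y z z' →
                       G x y (z F.+ z') (z F.+ z') ≈ G x y z z + 2 × G x y z z' + G x y z' z'
    pair-expansion₃₄ x y z z' = begin
      G x y (z F.+ z') (z F.+ z')
        ≈⟨ G-swapPairs x y _ _ ⟩
      G (z F.+ z') (z F.+ z') x y
        ≈⟨ pair-expansion₁₂ z z' x y ⟩
      G z z x y + 2 × G z z' x y + G z' z' x y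
        ≈⟨ +-cong (+-cong (G-swapPairs z z x y) (×-congʳ 2 (G-swapPairs z z' x y))) (G-swapPairs z' z' x y) ⟩
      G x y z z + 2 × G x y z z' + G x y z' z'
        ∎

    quartic-expansion : ∀ t u → let v = t F.+ u in
      G v v v v ≈ G t t t t + (4 × G t t t u + 6 × G t t u u + 4 × G t u u u) + G u u u u
    quartic-expansion t u = begin
      G v v v v
        ≈⟨ pair-expansion₁₂ t u v v ⟩
      G t t v v + 2 × G t u v v + G u u v v
        ≈⟨ +-cong (+-cong (pair-expansion₃₄ t t t u) (×-congʳ 2 (pair-expansion₃₄ t u t u)))
                  (pair-expansion₃₄ u u t u) ⟩
      (G t t t t + 2 × G t t t u + G t t u u) + 2 × (G t u t t + 2 × G t u t u + G t u u u)
        + (G u u t t + 2 × G u u t u + G u u u u)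
        ≈⟨ +-cong (+-congˡ (×-congʳ 2 (+-congʳ (+-cong (G-swapPairs t u t t)
                                                         (×-congʳ 2 (G-swap₂₃ t u t u))))))
                  (+-congʳ (+-cong (G-swapPairs u u t t) (×-congʳ 2 (G-swapPairs u u t u)))) ⟩
      (G t t t t + 2 × a + b) + 2 × (a + 2 × b + e) + (b + 2 × e + G u u u u)
        ≈⟨ solve 5 (λ p a b e q → (p :+ 2 :× a :+ b) :+ 2 :× (a :+ 2 :× b :+ e) :+ (b :+ 2 :× e :+ q)
                                     := p :+ (4 :× a :+ 6 :× b :+ 4 :× e) :+ q)
                 refl _ _ _ _ _ ⟩
      G t t t t + (4 × a + 6 × b + 4 × e) + G u u u u ∎
      where
      v = t F.+ u
      a = G t t t u
      b = G t t u u
      e = G t u u u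

    module _ (diagonal : ∀ t → G t t t t ≈ 0#) where

      mixedTerms : ∀ t u → 4 × G t t t u + 6 × G t t u u + 4 × G t u u u ≈ 0#
      mixedTerms t u =
        outer≈0⇒middle≈0 (diagonal t) (diagonal u) (trans (sym (quartic-expansion t u)) (diagonal (t F.+ u)))

      G-ttss : ∀ t s → G t t s s ≈ 0#
      G-ttss t s = ×-cancel K charZero 11 (begin
        12 × b
          ≈⟨ solve 3 (λ a b e → 12 :× b
                                  := (4 :× a :+ 6 :× b :+ 4 :× e) :+ (4 :× (:- a) :+ 6 :× b :+ 4 :× (:- e)))
                   refl a b e ⟩
        (4 × a + 6 × b + 4 × e) + (4 × - a + 6 × b + 4 × - e)
          ≈⟨ +-congˡ (+-cong (+-cong (×-congʳ 4 (G-neg₄ t t t s)) (×-congʳ 6 (G-neg₃₄ t t s s)))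
                             (×-congʳ 4 (trans (G-neg₂ t s _ _) (-‿cong (G-neg₃₄ t s s s))))) ⟨
        (4 × a + 6 × b + 4 × e)
          + (4 × G t t t (F.- s) + 6 × G t t (F.- s) (F.- s) + 4 × G t (F.- s) (F.- s) (F.- s))
          ≈⟨ +-cong (mixedTerms t s) (mixedTerms t (F.- s)) ⟩
        0# + 0#
          ≈⟨ +-identityʳ 0# ⟩
        0# ∎)
        where
        a = G t t t s
        b = G t t s s
        e = G t s s s

      G-xyzz : ∀ x y z → G x y z z ≈ 0#
      G-xyzz x y z = ×-cancel K charZero 1 (outer≈0⇒middle≈0 (G-ttss x z) (G-ttss y z)
        (trans (sym (pair-expansion₁₂ x y z z)) (G-ttss (x F.+ y) z)))

      diagonal-zero⇒zero : ∀ x y z w → G x y z w ≈ 0#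
      diagonal-zero⇒zero x y z w = ×-cancel K charZero 1 (outer≈0⇒middle≈0 (G-xyzz x y z) (G-xyzz x y w)
        (trans (sym (pair-expansion₃₄ x y z w)) (G-xyzz x y (z F.+ w))))

module SexticEquation {f ℓf k ℓk} (F : Field f ℓf) (K : Field k ℓk) (charZero : CharZero K)
                      (ι : Field.Carrier F → Field.Carrier K) (ι-hom : IsFieldEmbedding F K ι) where
  private
    module F where
      open Field F public
      open Formulas rawRing public using (_×_; _^_)
    module ι = RingMorphisms.IsRingHomomorphism ι-hom
  open Field K
  open Formulas rawRing
    using (_×_; sextic; quartic; umbralPow; shiftedSextic; secondDifference; dropConstant; powerDefect)
  open FormulaIdentities commutativeRing
    using (sextic-cong; umbralPow-cong; sextic-at-1#; powerDefect³; secondDifference-sextic)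
  open FieldEmbedding F K ι ι-hom using (ι-×1#; additive-binomial)
  open Defects F K ι ι-hom
  open SymmetricQuadriadditive F K charZero using (diagonal-zero⇒zero)
  open IntegerCoefficients commutativeRing using (solve; _:=_; _:+_; _:-_; _:×_; con)
  open import Algebra.Properties.Semiring.Mult semiring using (×-congʳ)
  open import Algebra.Properties.Group +-group using (ε⁻¹≈ε)
  open import Relation.Binary.Reasoning.Setoid setoid

  1#^n≈1# : ∀ n → F.1# F.^ n F.≈ F.1#
  1#^n≈1# zero    = F.refl
  1#^n≈1# (suc n) = F.trans (F.*-identityˡ _) (1#^n≈1# n)

  module _ {a : F.Carrier → Carrier} (a-cong : Congruent F K ι a) (a-add : Additive F K ι a)
           (equation : ∀ x → sextic (ι x) (a (x F.^ 6)) (a (x F.^ 4)) (a (x F.^ 3)) (a (x F.^ 2)) (a x) ≈ 0#)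
    where

    a-1#≈0# : a F.1# ≈ 0#
    a-1#≈0# = ×-cancel K charZero 10 (begin
      11 × a F.1#
        ≈⟨ sextic-at-1# (a F.1#) ⟩
      - sextic 1# (a F.1#) (a F.1#) (a F.1#) (a F.1#) (a F.1#)
        ≈⟨ -‿cong (sextic-cong ι.1#-homo (a-1^ 6) (a-1^ 4) (a-1^ 3) (a-1^ 2) refl) ⟨
      - sextic (ι F.1#) (a (F.1# F.^ 6)) (a (F.1# F.^ 4)) (a (F.1# F.^ 3)) (a (F.1# F.^ 2)) (a F.1#)
        ≈⟨ -‿cong (equation F.1#) ⟩
      - 0#
        ≈⟨ ε⁻¹≈ε ⟩
      0# ∎)
      where
      a-1^ : ∀ n → a (F.1# F.^ n) ≈ a F.1#
      a-1^ n = a-cong (1#^n≈1# n)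

    shifted-equation : ∀ x m → shiftedSextic (m × 1#) (ι x) (dropConstant λ i → a (x F.^ i)) ≈ 0#
    shifted-equation x m = begin
      shiftedSextic (m × 1#) (ι x) A₀
        ≈⟨ sextic-cong (trans (ι.+-homo x c) (+-congˡ (ι-×1# m)))
                       (shifted 6) (shifted 4) (shifted 3) (shifted 2)
                       (trans (a-cong (F.sym (F.*-identityʳ _))) (shifted 1)) ⟨
      sextic (ι (x F.+ c)) (a ((x F.+ c) F.^ 6)) (a ((x F.+ c) F.^ 4)) (a ((x F.+ c) F.^ 3))
             (a ((x F.+ c) F.^ 2)) (a (x F.+ c))
        ≈⟨ equation (x F.+ c) ⟩
      0# ∎
      where
      c  = m F.× F.1#
      A₀ = dropConstant λ i → a (x F.^ i)
      a≈A₀ : ∀ i → a (x F.^ i) ≈ A₀ i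
      a≈A₀ zero    = a-1#≈0#
      a≈A₀ (suc i) = refl
      shifted : ∀ n → a ((x F.+ c) F.^ n) ≈ umbralPow A₀ (m × 1#) n
      shifted n = trans (additive-binomial a-cong a-add m n x) (umbralPow-cong a≈A₀ (ι-×1# m) n)

    quartic-vanishes : ∀ x → quartic (ι x) (a (x F.^ 4)) (a (x F.^ 3)) (a (x F.^ 2)) (a (x F.^ 1)) ≈ 0#
    quartic-vanishes x = ×-cancel K charZero 41 (begin
      42 × quartic (ι x) (a (x F.^ 4)) (a (x F.^ 3)) (a (x F.^ 2)) (a (x F.^ 1))
        ≈⟨ secondDifference-sextic (ι x) (λ i → a (x F.^ i)) ⟨
      secondDifference (ι x) (λ i → a (x F.^ i))
        ≈⟨ +-cong (+-cong (shifted-equation x 2) (-‿cong (×-congʳ 2 (shifted-equation x 1))))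
                  (trans (sextic-cong refl refl refl refl refl (a-cong (F.*-identityʳ x))) (equation x)) ⟩
      (0# - 2 × 0#) + 0#
        ≈⟨ solve 0 ((con (+ 0) :- 2 :× con (+ 0)) :+ con (+ 0) := con (+ 0)) refl ⟩
      0# ∎)

    defect³ : F.Carrier → F.Carrier → F.Carrier → F.Carrier → Carrier
    defect³ x y z w = iteratedDefect a (y ∷ z ∷ w ∷ []) x

    defect³-diagonal : ∀ t → defect³ t t t t ≈ 0#
    defect³-diagonal t = begin
      iteratedDefect a (replicate 3 t) t
        ≈⟨ iteratedDefect-cong a-cong (replicate 3 t) (F.sym (F.*-identityʳ t)) ⟩
      iteratedDefect a (replicate 3 t) (t F.^ 1)
        ≈⟨ iteratedDefect-powers a-cong t (λ j → refl) 3 1 ⟩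
      iterate (powerDefect (ι t)) (λ j → a (t F.^ j)) 3 1
        ≈⟨ powerDefect³ (ι t) (λ j → a (t F.^ j)) ⟩
      quartic (ι t) (a (t F.^ 4)) (a (t F.^ 3)) (a (t F.^ 2)) (a (t F.^ 1))
        ≈⟨ quartic-vanishes t ⟩
      0# ∎

    defect³-swap₁₄ : ∀ x y z w → defect³ x y z w ≈ defect³ w y z x
    defect³-swap₁₄ x y z w = defect-comm (iteratedDefect-cong a-cong (y ∷ z ∷ [])) x w

    defect³-swap₃₄ : ∀ x y z w → defect³ x y z w ≈ defect³ x y w z
    defect³-swap₃₄ x y z w = defect-exchange (defect-cong a-cong y) x z w

    defect³-swap₂₃ : ∀ x y z w → defect³ x y z w ≈ defect³ x z y w
    defect³-swap₂₃ x y z w = defect-resp (λ u → defect-exchange a-cong u y z) x w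

    defect³-swap₁₂ : ∀ x y z w → defect³ x y z w ≈ defect³ y x z w
    defect³-swap₁₂ x y z w = begin
      defect³ x y z w  ≈⟨ defect³-swap₁₄ x y z w ⟩
      defect³ w y z x  ≈⟨ defect³-swap₃₄ w y z x ⟩
      defect³ w y x z  ≈⟨ defect³-swap₂₃ w y x z ⟩
      defect³ w x y z  ≈⟨ defect³-swap₃₄ w x y z ⟩
      defect³ w x z y  ≈⟨ defect³-swap₁₄ y x z w ⟨
      defect³ y x z w  ∎

    isDerivationOfOrder3 : IsDerivationOfOrder F K ι 3 a
    isDerivationOfOrder3 = isDerivationOfOrder-iteratedDefect 3 a-cong a-add λ where
      (y ∷ z ∷ w ∷ []) x →
        diagonal-zero⇒zero defect³
          (λ y z w → iteratedDefect-cong a-cong (y ∷ z ∷ w ∷ []))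
          (λ x x' y z w → iteratedDefect-additive a-cong a-add (y ∷ z ∷ w ∷ []) x x')
          defect³-swap₁₂ defect³-swap₂₃ defect³-swap₃₄ defect³-diagonal x y z w

lemma2p3 : ∀ {c ℓ c' ℓ' : Level} (F : Field c ℓ) (K : Field c' ℓ') → CharZero F → CharZero K → (ι : Field.Carrier F → Field.Carrier K) → IsFieldEmbedding F K ι → (a : Field.Carrier F → Field.Carrier K) → Congruent F K ι a → Additive F K ι a → (∀ x → let open Field K in (((natCast K 2 * a (pow F x 6) - natCast K 9 * pow K (ι x) 2 * a (pow F x 4)) - natCast K 4 * pow K (ι x) 3 * a (pow F x 3)) + natCast K 36 * pow K (ι x) 4 * a (pow F x 2)) - natCast K 36 * pow K (ι x) 5 * a x ≈ 0#) → IsDerivationOfOrder F K ι 3 a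
lemma2p3 F K _ charZeroK ι ι-hom a a-cong a-add equation =
  SexticEquation.isDerivationOfOrder3 F K charZeroK ι ι-hom a-cong a-add equation
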